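{- Let $w$ be a positive integer which is either a multiple of $4$ greater than $4$, or twice an odd composite number, or an odd composite number. Then the equation $u^2-v^2=-w^2$ has two distinct positive integral solutions $(u,v)=(x_1,x_2)$ and $(u,v)=(y_1,y_2)$, and for any such pair, the equation \[ (a-c)^2(b^2+1) = (b-c)^2(a^2+1) \] has the rational solutions \[ (a,b,c) = \pm\left(\frac{x_1}{w},\frac{y_1}{w},\frac{x_1y_2+x_2y_1}{w(y_2+x_2)}\right),\qquad \pm\left(\frac{x_1}{w},\frac{y_1}{w},\frac{x_1y_2-x_2y_1}{w(y_2-x_2)}\right). \] -}

module Defs where

open import Data.Nat as ℕ using (ℕ)
open import Data.Nat.Divisibility using (_∣_)
open import Data.Nat.Primality using (Composite)
open import Data.Integer as ℤ using (ℤ; +_)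
open import Data.Rational as ℚ using (ℚ; 0ℚ; 1ℚ; _*_; _+_; _-_; 1/_; ≢-nonZero)
open import Data.Rational.Properties using (_≟_)
open import Data.Product using (Σ; _×_; ∃)
open import Data.Sum using (_⊎_)
open import Relation.Binary.PropositionalEquality using (_≡_)
open import Relation.Nullary using (¬_; yes; no)

OddComposite : ℕ → Set
OddComposite m = ¬ (2 ∣ m) × Composite m

WCond : ℕ → Set
WCond w = (4 ∣ w × 4 ℕ.< w)
        ⊎ (Σ ℕ λ m → w ≡ 2 ℕ.* m × OddComposite m)
        ⊎ OddComposite w

PosSol : ℕ → ℤ → ℤ → Set
PosSol w u v = ℤ.+0 ℤ.< u × ℤ.+0 ℤ.< v
             × u ℤ.* u ℤ.- v ℤ.* v ≡ ℤ.- ((+ w) ℤ.* (+ w))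

ι : ℤ → ℚ
ι z = z ℚ./ 1

-- total division on ℚ (q ÷ 0 = 0); only used with nonzero divisors
_÷_ : ℚ → ℚ → ℚ
p ÷ q with q ≟ 0ℚ
... | yes _ = 0ℚ
... | no q≢0 = p * (1/_ q {{≢-nonZero q≢0}})

Eqn : ℚ → ℚ → ℚ → Set
Eqn a b c = (a - c) * (a - c) * (b * b + 1ℚ) ≡ (b - c) * (b - c) * (a * a + 1ℚ)

{-# OPTIONS --safe #-}
-- A positive solution (u, v) of u² − v² = −w² is a Pythagorean triple (u, w, v), and triples
-- can be scaled. If w = 2qd with q, d > 1, the triples (n² − 1, 2n, n² + 1) for n = qd and q
-- times the one for n = d have v − u equal to 2 and 2q; if w = qd is odd, the triples
-- ((n² − 1)/2, n, (n² + 1)/2) for n = w and q times the one for n = d have v − u equal to 1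
-- and q. Both w = 4k with k > 1 and w = 2m with m composite are of the first kind.
--
-- With a = x₁/w, α = x₂/w, b = y₁/w, β = y₂/w we have a² + 1 = α² and b² + 1 = β², and c₊ is
-- the weighted mean c = (aβ + bα)/(α + β). It satisfies (a − c)β = −(b − c)α, and squaring
-- this gives (a − c)²(b² + 1) = (b − c)²(a² + 1). Replacing x₂ by −x₂ turns c₊ into c₋, and
-- the equation is invariant under (a, b, c) ↦ (−a, −b, −c).
module Submission where

open import Defs
open import Data.Nat as ℕ using (ℕ)
open import Data.Integer as ℤ using (ℤ; +_)
open import Data.Rational as ℚ using (ℚ; -_)
open import Data.Product using (Σ; _×_; _,_)
open import Relation.Binary.PropositionalEquality using (_≡_)
open import Relation.Nullary using (¬_)

open import Data.List using (_∷_; [])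
open import Data.Product using (∃₂; proj₁; proj₂)
open import Data.Sum using (inj₁; inj₂; [_,_]′)
open import Function using (_∘_)
open import Relation.Binary.PropositionalEquality
  using (_≢_; refl; sym; trans; cong; cong₂; subst; module ≡-Reasoning)
open import Relation.Nullary using (yes; no; contradiction)

module _ where
  open import Data.Integer using (0ℤ; _+_; _*_; _-_; _<_)
  open import Data.Integer.Properties
    using (pos-+; pos-*; +-mono-<; <-irrefl; i*j≡0⇒i≡0∨j≡0; i≡j⇒i-j≡0; i-j≡0⇒i≡j)
  open import Data.Integer.Tactic.RingSolver using (solve)
  open ≡-Reasoning

  sum⇒difference : ∀ x y z → x * x + z * z ≡ y * y → x * x - y * y ≡ ℤ.- (z * z)
  sum⇒difference x y z eq = begin
    x * x - y * y            ≡⟨ cong (λ t → x * x - t) eq ⟨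
    x * x - (x * x + z * z)  ≡⟨ solve (x ∷ z ∷ []) ⟩
    ℤ.- (z * z)              ∎

  difference⇒sum : ∀ x y z → x * x - y * y ≡ ℤ.- (z * z) → x * x + z * z ≡ y * y
  difference⇒sum x y z eq = begin
    x * x + z * z                    ≡⟨ solve (x ∷ y ∷ z ∷ []) ⟩
    (x * x - y * y) + z * z + y * y  ≡⟨ cong (λ t → t + z * z + y * y) eq ⟩
    ℤ.- (z * z) + z * z + y * y      ≡⟨ solve (y ∷ z ∷ []) ⟩
    y * y                            ∎

  pos-pythagorean : ∀ u v w → u ℕ.* u ℕ.+ w ℕ.* w ≡ v ℕ.* v → + u * + u + + w * + w ≡ + v * + v
  pos-pythagorean u v w eq = begin
    + u * + u + + w * + w      ≡⟨ cong₂ _+_ (pos-* u u) (pos-* w w) ⟨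
    + (u ℕ.* u) + + (w ℕ.* w)  ≡⟨ pos-+ (u ℕ.* u) (w ℕ.* w) ⟨
    + (u ℕ.* u ℕ.+ w ℕ.* w)    ≡⟨ cong +_ eq ⟩
    + (v ℕ.* v)                ≡⟨ pos-* v v ⟩
    + v * + v                  ∎

  neg-square : ∀ x → ℤ.- x * ℤ.- x ≡ x * x
  neg-square x = solve (x ∷ [])

  positive-sum≢0 : ∀ {m n} → 0ℤ < m → 0ℤ < n → m + n ≢ 0ℤ
  positive-sum≢0 m>0 n>0 m+n≡0 = <-irrefl (sym m+n≡0) (+-mono-< m>0 n>0)

  positive-square-injective : ∀ {m n} → 0ℤ < m → 0ℤ < n → m * m ≡ n * n → m ≡ n
  positive-square-injective {m} {n} m>0 n>0 m²≡n² =
    [ i-j≡0⇒i≡j m n , (λ m+n≡0 → contradiction m+n≡0 (positive-sum≢0 m>0 n>0)) ]′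
      (i*j≡0⇒i≡0∨j≡0 (m - n) difference-of-squares)
    where
    difference-of-squares : (m - n) * (m + n) ≡ 0ℤ
    difference-of-squares = begin
      (m - n) * (m + n)  ≡⟨ solve (m ∷ n ∷ []) ⟩
      m * m - n * n      ≡⟨ i≡j⇒i-j≡0 m²≡n² ⟩
      0ℤ                 ∎

module _ where
  open import Data.Nat using (suc; _+_; _*_; _<_; z<s; s<s)
  open import Data.Nat.Properties
    using (*-suc; *-identityʳ; *-mono-<; *-cancelʳ-≡; <-irrefl; <-trans; <-≤-trans; m≤m+n; +-cancelˡ-≡)
  open import Data.Nat.Divisibility
    using (_∣_; divides; ∣-refl; ∣-trans; n∣m*n; ∣m∣n⇒∣m+n; quotient; quotient>1; m∣n⇒n≡quotient*m)
  open import Data.Nat.Divisibility.Core using (hasNonTrivialDivisor)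
  open import Data.Nat.Base using (nonTrivial⇒n>1)
  open import Data.Nat.Primality using (Composite)
  open import Data.Nat.Tactic.RingSolver using (solve)
  open import Data.Integer using (+<+)
  open import Data.Integer.Properties using (+-injective)
  open ≡-Reasoning

  record PythagoreanTriple (w δ : ℕ) : Set where
    field
      leg        : ℕ
      leg>0      : 0 < leg
      pythagoras : leg * leg + w * w ≡ (leg + δ) * (leg + δ)
  open PythagoreanTriple

  scale : ∀ {w δ} d → 0 < d → PythagoreanTriple w δ → PythagoreanTriple (d * w) (d * δ)
  scale {w} {δ} d d>0 record { leg = u ; leg>0 = u>0 ; pythagoras = eq } = record
    { leg = d * u ; leg>0 = *-mono-< d>0 u>0 ; pythagoras = begin
        d * u * (d * u) + d * w * (d * w)  ≡⟨ solve (d ∷ u ∷ w ∷ []) ⟩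
        d * d * (u * u + w * w)            ≡⟨ cong (d * d *_) eq ⟩
        d * d * ((u + δ) * (u + δ))        ≡⟨ solve (d ∷ u ∷ δ ∷ []) ⟩
        (d * u + d * δ) * (d * u + d * δ)  ∎ }

  even-triple : ∀ n → 1 < n → PythagoreanTriple (2 * n) 2
  even-triple 1             (s<s ())
  even-triple (suc (suc k)) _ = record
    { leg = (1 + k) * (3 + k) ; leg>0 = z<s ; pythagoras = solve (k ∷ []) }

  odd⇒suc-double : ∀ n → ¬ 2 ∣ n → Σ ℕ λ k → n ≡ suc (2 * k)
  odd⇒suc-double 0             odd = contradiction (divides 0 refl) odd
  odd⇒suc-double 1             _   = 0 , refl
  odd⇒suc-double (suc (suc n)) odd with odd⇒suc-double n (odd ∘ ∣m∣n⇒∣m+n ∣-refl)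
  ... | k , refl = suc k , cong suc (sym (*-suc 2 k))

  odd-triple : ∀ {w} → ¬ 2 ∣ w → 1 < w → PythagoreanTriple w 1
  odd-triple {w} odd 1<w with odd⇒suc-double w odd
  ... | 0     , refl = contradiction 1<w (<-irrefl refl)
  ... | suc k , refl = record
    { leg = 2 * (1 + k) * (2 + k) ; leg>0 = z<s ; pythagoras = solve (k ∷ []) }

  TwoDistinctPosSols : ℕ → Set
  TwoDistinctPosSols w = Σ ℤ λ x₁ → Σ ℤ λ x₂ → Σ ℤ λ y₁ → Σ ℤ λ y₂ →
    PosSol w x₁ x₂ × PosSol w y₁ y₂ × ¬ ((x₁ , x₂) ≡ (y₁ , y₂))

  triple⇒PosSol : ∀ {w δ} (t : PythagoreanTriple w δ) → PosSol w (+ leg t) (+ (leg t + δ))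
  triple⇒PosSol {w} {δ} t =
    +<+ (leg>0 t) , +<+ (<-≤-trans (leg>0 t) (m≤m+n (leg t) δ)) ,
    sum⇒difference (+ leg t) (+ (leg t + δ)) (+ w) (pos-pythagorean (leg t) (leg t + δ) w (pythagoras t))

  distinct-triples : ∀ {w δ δ′} → PythagoreanTriple w δ → PythagoreanTriple w δ′ → δ ≢ δ′ →
                     TwoDistinctPosSols w
  distinct-triples {δ = δ} {δ′} s t δ≢δ′ =
    + leg s , + (leg s + δ) , + leg t , + (leg t + δ′) , triple⇒PosSol s , triple⇒PosSol t , δ≢δ′ ∘ same-gap
    where
    same-gap : (+ leg s , + (leg s + δ)) ≡ (+ leg t , + (leg t + δ′)) → δ ≡ δ′
    same-gap eq with +-injective (cong proj₁ eq) | +-injective (cong proj₂ eq)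
    ... | refl | hyp≡hyp′ = +-cancelˡ-≡ (leg s) δ δ′ hyp≡hyp′

  twoDistinctPosSols-2qd : ∀ q d → 1 < q → 1 < d → TwoDistinctPosSols (2 * (q * d))
  twoDistinctPosSols-2qd q d 1<q 1<d = distinct-triples
    (even-triple (q * d) (*-mono-< 1<q 1<d))
    (subst (λ w → PythagoreanTriple w (q * 2)) reassociate (scale q (<-trans z<s 1<q) (even-triple d 1<d)))
    (λ 2≡q*2 → <-irrefl (*-cancelʳ-≡ 1 q 2 2≡q*2) 1<q)
    where
    reassociate : q * (2 * d) ≡ 2 * (q * d)
    reassociate = solve (q ∷ d ∷ [])

  twoDistinctPosSols-odd-qd : ∀ q d → 1 < q → 1 < d → ¬ 2 ∣ q * d → TwoDistinctPosSols (q * d)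
  twoDistinctPosSols-odd-qd q d 1<q 1<d odd = distinct-triples
    (odd-triple odd (*-mono-< 1<q 1<d))
    (scale q (<-trans z<s 1<q) (odd-triple (odd ∘ λ 2∣d → ∣-trans 2∣d (n∣m*n q)) 1<d))
    (λ 1≡q*1 → <-irrefl (trans 1≡q*1 (*-identityʳ q)) 1<q)

  composite⇒nontrivial-product : ∀ {m} → Composite m → ∃₂ λ q d → 1 < q × 1 < d × m ≡ q * d
  composite⇒nontrivial-product (hasNonTrivialDivisor {d} d<m d∣m) =
    quotient d∣m , d , quotient>1 d∣m d<m , nonTrivial⇒n>1 d , m∣n⇒n≡quotient*m d∣m

  WCond⇒twoDistinctPosSols : ∀ {w} → WCond w → TwoDistinctPosSols w
  WCond⇒twoDistinctPosSols (inj₁ (4∣w@(divides k refl) , 4<w)) =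
    subst TwoDistinctPosSols reassociate (twoDistinctPosSols-2qd k 2 (quotient>1 4∣w 4<w) (s<s z<s))
    where
    reassociate : 2 * (k * 2) ≡ k * 4
    reassociate = solve (k ∷ [])
  WCond⇒twoDistinctPosSols (inj₂ (inj₁ (m , refl , _ , m-composite)))
    with composite⇒nontrivial-product m-composite
  ... | q , d , 1<q , 1<d , refl = twoDistinctPosSols-2qd q d 1<q 1<d
  WCond⇒twoDistinctPosSols (inj₂ (inj₂ (w-odd , w-composite)))
    with composite⇒nontrivial-product w-composite
  ... | q , d , 1<q , 1<d , refl = twoDistinctPosSols-odd-qd q d 1<q 1<d w-odd

module _ where
  open import Data.Rational using (_+_; _*_; toℚᵘ)
  open import Data.Rational.Properties
    using (toℚᵘ-injective; toℚᵘ-cong; toℚᵘ-fromℚᵘ; toℚᵘ-homo-+; toℚᵘ-homo-*)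
  open import Data.Rational.Unnormalised as ℚᵘ using (ℚᵘ; mkℚᵘ; _≃_)
  import Data.Rational.Unnormalised.Properties as ℚᵘ
  import Data.Integer.Properties as ℤ

  [_]ᵘ : ℤ → ℚᵘ
  [ z ]ᵘ = mkℚᵘ z 0

  toℚᵘ-ι : ∀ z → toℚᵘ (ι z) ≃ [ z ]ᵘ
  toℚᵘ-ι z = toℚᵘ-fromℚᵘ [ z ]ᵘ

  ι-injective : ∀ {m n} → ι m ≡ ι n → m ≡ n
  ι-injective {m} {n} ιm≡ιn = begin
    m           ≡⟨ ℤ.*-identityʳ m ⟨
    m ℤ.* ℤ.1ℤ  ≡⟨ ℚᵘ.drop-*≡* [m]≃[n] ⟩
    n ℤ.* ℤ.1ℤ  ≡⟨ ℤ.*-identityʳ n ⟩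
    n           ∎
    where
    open ≡-Reasoning
    [m]≃[n] : [ m ]ᵘ ≃ [ n ]ᵘ
    [m]≃[n] = ℚᵘ.≃-trans (ℚᵘ.≃-sym (toℚᵘ-ι m)) (ℚᵘ.≃-trans (toℚᵘ-cong ιm≡ιn) (toℚᵘ-ι n))

  ι-* : ∀ m n → ι (m ℤ.* n) ≡ ι m * ι n
  ι-* m n = toℚᵘ-injective (begin
    toℚᵘ (ι (m ℤ.* n))          ≈⟨ toℚᵘ-ι (m ℤ.* n) ⟩
    [ m ]ᵘ ℚᵘ.* [ n ]ᵘ          ≈⟨ ℚᵘ.*-cong (toℚᵘ-ι m) (toℚᵘ-ι n) ⟨
    toℚᵘ (ι m) ℚᵘ.* toℚᵘ (ι n)  ≈⟨ toℚᵘ-homo-* (ι m) (ι n) ⟨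
    toℚᵘ (ι m * ι n)            ∎)
    where open ℚᵘ.≃-Reasoning

  ι-+ : ∀ m n → ι (m ℤ.+ n) ≡ ι m + ι n
  ι-+ m n = toℚᵘ-injective (begin
    toℚᵘ (ι (m ℤ.+ n))          ≈⟨ toℚᵘ-ι (m ℤ.+ n) ⟩
    [ m ℤ.+ n ]ᵘ                ≈⟨ ℚᵘ.≃-reflexive (cong [_]ᵘ m*1+n*1≡m+n) ⟨
    [ m ]ᵘ ℚᵘ.+ [ n ]ᵘ          ≈⟨ ℚᵘ.+-cong (toℚᵘ-ι m) (toℚᵘ-ι n) ⟨
    toℚᵘ (ι m) ℚᵘ.+ toℚᵘ (ι n)  ≈⟨ toℚᵘ-homo-+ (ι m) (ι n) ⟨
    toℚᵘ (ι m + ι n)            ∎)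
    where
    open ℚᵘ.≃-Reasoning
    m*1+n*1≡m+n : m ℤ.* ℤ.1ℤ ℤ.+ n ℤ.* ℤ.1ℤ ≡ m ℤ.+ n
    m*1+n*1≡m+n = cong₂ ℤ._+_ (ℤ.*-identityʳ m) (ℤ.*-identityʳ n)

  ι-pythagorean : ∀ x y z → x ℤ.* x ℤ.+ z ℤ.* z ≡ y ℤ.* y → ι x * ι x + ι z * ι z ≡ ι y * ι y
  ι-pythagorean x y z eq = begin
    ι x * ι x + ι z * ι z      ≡⟨ cong₂ _+_ (ι-* x x) (ι-* z z) ⟨
    ι (x ℤ.* x) + ι (z ℤ.* z)  ≡⟨ ι-+ (x ℤ.* x) (z ℤ.* z) ⟨
    ι (x ℤ.* x ℤ.+ z ℤ.* z)    ≡⟨ cong ι eq ⟩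
    ι (y ℤ.* y)                ≡⟨ ι-* y y ⟩
    ι y * ι y                  ∎
    where open ≡-Reasoning

module _ where
  open import Data.Rational using (0ℚ; 1ℚ; _+_; _*_; _-_; 1/_; ≢-nonZero)
  open import Data.Rational.Properties using (_≟_; *-identityˡ; *-identityʳ; *-inverseʳ)
  open import Data.Rational.Solver using (module +-*-Solver)
  open +-*-Solver using (solve; _:+_; _:-_; _:*_; :-_; _:=_; con)
  open import Data.Integer.Properties using (i*j≡0⇒i≡0∨j≡0)
  open ≡-Reasoning

  ÷-≡-*-1/ : ∀ p {q} (q≢0 : q ≢ 0ℚ) → p ÷ q ≡ p * (1/ q) {{≢-nonZero q≢0}}
  ÷-≡-*-1/ p {q} q≢0 with q ≟ 0ℚ
  ... | yes q≡0 = contradiction q≡0 q≢0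
  ... | no _    = refl

  square-add-one : ∀ X X′ W r → X * X + W * W ≡ X′ * X′ → W * r ≡ 1ℚ →
                   (X * r) * (X * r) + 1ℚ ≡ (X′ * r) * (X′ * r)
  square-add-one X X′ W r eq Wr≡1 = begin
    (X * r) * (X * r) + 1ℚ                 ≡⟨ cong (λ t → (X * r) * (X * r) + t * t) Wr≡1 ⟨
    (X * r) * (X * r) + (W * r) * (W * r)  ≡⟨ solve 3 (λ X W r →
                                                (X :* r) :* (X :* r) :+ (W :* r) :* (W :* r)
                                                := (X :* X :+ W :* W) :* (r :* r)) refl X W r ⟩
    (X * X + W * W) * (r * r)              ≡⟨ cong (_* (r * r)) eq ⟩
    (X′ * X′) * (r * r)                    ≡⟨ solve 2 (λ X′ r →
                                                (X′ :* X′) :* (r :* r) := (X′ :* r) :* (X′ :* r)) refl X′ r ⟩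
    (X′ * r) * (X′ * r)                    ∎

  inverse-of-product : ∀ W S r s → W * r ≡ 1ℚ → W * S * s ≡ 1ℚ → S * s ≡ r
  inverse-of-product W S r s Wr≡1 WSs≡1 = begin
    S * s            ≡⟨ *-identityʳ (S * s) ⟨
    S * s * 1ℚ       ≡⟨ cong (S * s *_) Wr≡1 ⟨
    S * s * (W * r)  ≡⟨ solve 4 (λ W S r s → S :* s :* (W :* r) := W :* S :* s :* r) refl W S r s ⟩
    W * S * s * r    ≡⟨ cong (_* r) WSs≡1 ⟩
    1ℚ * r           ≡⟨ *-identityˡ r ⟩
    r                ∎

  Eqn-cong : ∀ {a a′ b b′ c c′} → a′ ≡ a → b′ ≡ b → c′ ≡ c → Eqn a b c → Eqn a′ b′ c′
  Eqn-cong refl refl refl eqn = eqn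

  Eqn-neg : ∀ a b c → Eqn a b c → Eqn (- a) (- b) (- c)
  Eqn-neg a b c eqn = begin
    (- a - - c) * (- a - - c) * (- b * - b + 1ℚ)  ≡⟨ negate-all a b c ⟩
    (a - c) * (a - c) * (b * b + 1ℚ)              ≡⟨ eqn ⟩
    (b - c) * (b - c) * (a * a + 1ℚ)              ≡⟨ negate-all b a c ⟨
    (- b - - c) * (- b - - c) * (- a * - a + 1ℚ)  ∎
    where
    negate-all : ∀ x y z → (- x - - z) * (- x - - z) * (- y * - y + 1ℚ) ≡ (x - z) * (x - z) * (y * y + 1ℚ)
    negate-all = solve 3 (λ x y z → (:- x :- :- z) :* (:- x :- :- z) :* (:- y :* :- y :+ con 1ℚ)
                                  := (x :- z) :* (x :- z) :* (y :* y :+ con 1ℚ)) refl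

  Eqn-of-mean : ∀ a b c α β → a * a + 1ℚ ≡ α * α → b * b + 1ℚ ≡ β * β →
                c * (α + β) ≡ a * β + b * α → Eqn a b c
  Eqn-of-mean a b c α β a²+1≡α² b²+1≡β² mean = begin
    (a - c) * (a - c) * (b * b + 1ℚ)       ≡⟨ cong ((a - c) * (a - c) *_) b²+1≡β² ⟩
    (a - c) * (a - c) * (β * β)            ≡⟨ solve 3 (λ a c β →
                                                 (a :- c) :* (a :- c) :* (β :* β)
                                                 := ((a :- c) :* β) :* ((a :- c) :* β)) refl a c β ⟩
    ((a - c) * β) * ((a - c) * β)          ≡⟨ cong (λ t → t * t) opposite ⟩
    (- ((b - c) * α)) * (- ((b - c) * α))  ≡⟨ solve 3 (λ b c α →
                                                 (:- ((b :- c) :* α)) :* (:- ((b :- c) :* α))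
                                                 := (b :- c) :* (b :- c) :* (α :* α)) refl b c α ⟩
    (b - c) * (b - c) * (α * α)            ≡⟨ cong ((b - c) * (b - c) *_) a²+1≡α² ⟨
    (b - c) * (b - c) * (a * a + 1ℚ)       ∎
    where
    opposite : (a - c) * β ≡ - ((b - c) * α)
    opposite = begin
      (a - c) * β                                      ≡⟨ solve 5 (λ a b c α β →
                                                            (a :- c) :* β
                                                            := (a :* β :+ b :* α) :- c :* (α :+ β) :- (b :- c) :* α)
                                                            refl a b c α β ⟩
      (a * β + b * α) - c * (α + β) - (b - c) * α      ≡⟨ cong (λ t → (a * β + b * α) - t - (b - c) * α) mean ⟩
      (a * β + b * α) - (a * β + b * α) - (b - c) * α  ≡⟨ solve 5 (λ a b c α β →
                                                            (a :* β :+ b :* α) :- (a :* β :+ b :* α) :- (b :- c) :* α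
                                                            := :- ((b :- c) :* α)) refl a b c α β ⟩
      - ((b - c) * α)                                  ∎

  Eqn-of-hyperbola-points : ∀ X₁ X₂ Y₁ Y₂ W r s →
    X₁ * X₁ + W * W ≡ X₂ * X₂ → Y₁ * Y₁ + W * W ≡ Y₂ * Y₂ →
    W * r ≡ 1ℚ → W * (Y₂ + X₂) * s ≡ 1ℚ →
    Eqn (X₁ * r) (Y₁ * r) ((X₁ * Y₂ + X₂ * Y₁) * s)
  Eqn-of-hyperbola-points X₁ X₂ Y₁ Y₂ W r s x-sol y-sol Wr≡1 Ds≡1 =
    Eqn-of-mean (X₁ * r) (Y₁ * r) (N * s) (X₂ * r) (Y₂ * r)
      (square-add-one X₁ X₂ W r x-sol Wr≡1) (square-add-one Y₁ Y₂ W r y-sol Wr≡1) mean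
    where
    N : ℚ
    N = X₁ * Y₂ + X₂ * Y₁
    mean : N * s * (X₂ * r + Y₂ * r) ≡ X₁ * r * (Y₂ * r) + Y₁ * r * (X₂ * r)
    mean = begin
      N * s * (X₂ * r + Y₂ * r)              ≡⟨ solve 6 (λ X₁ X₂ Y₁ Y₂ r s →
                                                  (X₁ :* Y₂ :+ X₂ :* Y₁) :* s :* (X₂ :* r :+ Y₂ :* r)
                                                  := (X₁ :* Y₂ :+ X₂ :* Y₁) :* r :* ((Y₂ :+ X₂) :* s))
                                                  refl X₁ X₂ Y₁ Y₂ r s ⟩
      N * r * ((Y₂ + X₂) * s)                ≡⟨ cong (N * r *_) (inverse-of-product W (Y₂ + X₂) r s Wr≡1 Ds≡1) ⟩
      N * r * r                              ≡⟨ solve 5 (λ X₁ X₂ Y₁ Y₂ r →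
                                                  (X₁ :* Y₂ :+ X₂ :* Y₁) :* r :* r
                                                  := X₁ :* r :* (Y₂ :* r) :+ Y₁ :* r :* (X₂ :* r))
                                                  refl X₁ X₂ Y₁ Y₂ r ⟩
      X₁ * r * (Y₂ * r) + Y₁ * r * (X₂ * r)  ∎

  Eqn-of-integer-points : ∀ w x₁ x₂ y₁ y₂ → w ≢ ℤ.0ℤ → y₂ ℤ.+ x₂ ≢ ℤ.0ℤ →
    x₁ ℤ.* x₁ ℤ.+ w ℤ.* w ≡ x₂ ℤ.* x₂ → y₁ ℤ.* y₁ ℤ.+ w ℤ.* w ≡ y₂ ℤ.* y₂ →
    Eqn (ι x₁ ÷ ι w) (ι y₁ ÷ ι w) (ι (x₁ ℤ.* y₂ ℤ.+ x₂ ℤ.* y₁) ÷ ι (w ℤ.* (y₂ ℤ.+ x₂)))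
  Eqn-of-integer-points w x₁ x₂ y₁ y₂ w≢0 S≢0 x-sol y-sol =
    Eqn-cong (÷-≡-*-1/ (ι x₁) W≢0) (÷-≡-*-1/ (ι y₁) W≢0) c≡Ns
      (Eqn-of-hyperbola-points (ι x₁) (ι x₂) (ι y₁) (ι y₂) (ι w) r s
        (ι-pythagorean x₁ x₂ w x-sol) (ι-pythagorean y₁ y₂ w y-sol) Wr≡1 Ds≡1)
    where
    D : ℤ
    D = w ℤ.* (y₂ ℤ.+ x₂)
    W≢0 : ι w ≢ 0ℚ
    W≢0 = w≢0 ∘ ι-injective
    D≢0 : ι D ≢ 0ℚ
    D≢0 = [ w≢0 , S≢0 ]′ ∘ i*j≡0⇒i≡0∨j≡0 w ∘ ι-injective
    r s : ℚ
    r = (1/ ι w) {{≢-nonZero W≢0}}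
    s = (1/ ι D) {{≢-nonZero D≢0}}
    Wr≡1 : ι w * r ≡ 1ℚ
    Wr≡1 = *-inverseʳ (ι w) {{≢-nonZero W≢0}}
    Ds≡1 : ι w * (ι y₂ + ι x₂) * s ≡ 1ℚ
    Ds≡1 = subst (λ t → t * s ≡ 1ℚ) (trans (ι-* w _) (cong (ι w *_) (ι-+ y₂ x₂)))
             (*-inverseʳ (ι D) {{≢-nonZero D≢0}})
    c≡Ns : ι (x₁ ℤ.* y₂ ℤ.+ x₂ ℤ.* y₁) ÷ ι D ≡ (ι x₁ * ι y₂ + ι x₂ * ι y₁) * s
    c≡Ns = trans (÷-≡-*-1/ _ D≢0)
             (cong (_* s) (trans (ι-+ (x₁ ℤ.* y₂) (x₂ ℤ.* y₁)) (cong₂ _+_ (ι-* x₁ y₂) (ι-* x₂ y₁))))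

module _ where
  open import Data.Integer.Properties using (+-injective; i-j≡0⇒i≡j; neg-distribˡ-*; +-0-abelianGroup)
  open import Algebra.Properties.AbelianGroup +-0-abelianGroup using (∙-cancelʳ)
  import Data.Nat.Properties as ℕ

  Eqn-at-solutions : ∀ {w} → 0 ℕ.< w → (x₁ x₂ y₁ y₂ : ℤ) →
    PosSol w x₁ x₂ → PosSol w y₁ y₂ → ¬ ((x₁ , x₂) ≡ (y₁ , y₂)) →
    let a = ι x₁ ÷ ι (+ w)
        b = ι y₁ ÷ ι (+ w)
        c₊ = ι (x₁ ℤ.* y₂ ℤ.+ x₂ ℤ.* y₁) ÷ ι ((+ w) ℤ.* (y₂ ℤ.+ x₂))
        c₋ = ι (x₁ ℤ.* y₂ ℤ.- x₂ ℤ.* y₁) ÷ ι ((+ w) ℤ.* (y₂ ℤ.- x₂))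
    in Eqn a b c₊ × Eqn (- a) (- b) (- c₊) × Eqn a b c₋ × Eqn (- a) (- b) (- c₋)
  Eqn-at-solutions {w} w>0 x₁ x₂ y₁ y₂ (x₁>0 , x₂>0 , x-sol) (y₁>0 , y₂>0 , y-sol) x≢y =
    E₊ , Eqn-neg a b c₊ E₊ , E₋ , Eqn-neg a b c₋ E₋
    where
    a b c₊ c₋ : ℚ
    a = ι x₁ ÷ ι (+ w)
    b = ι y₁ ÷ ι (+ w)
    c₊ = ι (x₁ ℤ.* y₂ ℤ.+ x₂ ℤ.* y₁) ÷ ι ((+ w) ℤ.* (y₂ ℤ.+ x₂))
    c₋ = ι (x₁ ℤ.* y₂ ℤ.- x₂ ℤ.* y₁) ÷ ι ((+ w) ℤ.* (y₂ ℤ.- x₂))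
    w≢0 : + w ≢ ℤ.0ℤ
    w≢0 w≡0 = ℕ.<-irrefl (sym (+-injective w≡0)) w>0
    x-pyth : x₁ ℤ.* x₁ ℤ.+ + w ℤ.* + w ≡ x₂ ℤ.* x₂
    x-pyth = difference⇒sum x₁ x₂ (+ w) x-sol
    y-pyth : y₁ ℤ.* y₁ ℤ.+ + w ℤ.* + w ≡ y₂ ℤ.* y₂
    y-pyth = difference⇒sum y₁ y₂ (+ w) y-sol
    y₂-x₂≢0 : y₂ ℤ.- x₂ ≢ ℤ.0ℤ
    y₂-x₂≢0 y₂-x₂≡0 with i-j≡0⇒i≡j y₂ x₂ y₂-x₂≡0
    ... | refl = x≢y (cong (_, y₂) (positive-square-injective x₁>0 y₁>0 (∙-cancelʳ _ _ _ (trans x-sol (sym y-sol)))))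
    E₊ : Eqn a b c₊
    E₊ = Eqn-of-integer-points (+ w) x₁ x₂ y₁ y₂ w≢0 (positive-sum≢0 y₂>0 x₂>0) x-pyth y-pyth
    E₋ : Eqn a b c₋
    E₋ = subst (λ n → Eqn a b (ι n ÷ ι ((+ w) ℤ.* (y₂ ℤ.- x₂))))
           (cong (ℤ._+_ (x₁ ℤ.* y₂)) (sym (neg-distribˡ-* x₂ y₁)))
           (Eqn-of-integer-points (+ w) x₁ (ℤ.- x₂) y₁ y₂ w≢0 y₂-x₂≢0 (trans x-pyth (sym (neg-square x₂))) y-pyth)

theorem1p10 : (w : ℕ) → 0 ℕ.< w → WCond w →
  (Σ ℤ λ x₁ → Σ ℤ λ x₂ → Σ ℤ λ y₁ → Σ ℤ λ y₂ →
    PosSol w x₁ x₂ × PosSol w y₁ y₂ × ¬ ((x₁ , x₂) ≡ (y₁ , y₂)))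
  × ((x₁ x₂ y₁ y₂ : ℤ) → PosSol w x₁ x₂ → PosSol w y₁ y₂ → ¬ ((x₁ , x₂) ≡ (y₁ , y₂)) →
    let a = ι x₁ ÷ ι (+ w)
        b = ι y₁ ÷ ι (+ w)
        c₊ = ι (x₁ ℤ.* y₂ ℤ.+ x₂ ℤ.* y₁) ÷ ι ((+ w) ℤ.* (y₂ ℤ.+ x₂))
        c₋ = ι (x₁ ℤ.* y₂ ℤ.- x₂ ℤ.* y₁) ÷ ι ((+ w) ℤ.* (y₂ ℤ.- x₂))
    in Eqn a b c₊ × Eqn (- a) (- b) (- c₊) × Eqn a b c₋ × Eqn (- a) (- b) (- c₋))
theorem1p10 w w>0 wcond = WCond⇒twoDistinctPosSols wcond , Eqn-at-solutions w>0
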